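{- Let $u$ be a finite word and let $\alpha,\beta$ be letters. If $u\beta$ is a factor of an overlap of $u\alpha$, then $\alpha=\beta$.
   Context: For a finite word $q$, an overlap of $q$ is a word $w$ having $q$ both as a prefix and as a suffix and such that $|q|<|w|\le 2|q|$. A factor of a word is a contiguous subword. -}

module Defs where

open import Data.List using (List; length; _++_; [_])
open import Data.Nat using (_<_; _≤_; _*_)
open import Data.Product using (Σ; ∃; _×_)
open import Relation.Binary.PropositionalEquality using (_≡_)

IsPrefix : {A : Set} → List A → List A → Set
IsPrefix {A} q w = Σ (List A) λ r → q ++ r ≡ w

IsSuffix : {A : Set} → List A → List A → Set
IsSuffix {A} q w = Σ (List A) λ l → l ++ q ≡ w

IsFactor : {A : Set} → List A → List A → Set
IsFactor {A} v w = Σ (List A) λ l → Σ (List A) λ r → l ++ v ++ r ≡ w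

IsOverlapOf : {A : Set} → List A → List A → Set
IsOverlapOf w q =
  IsPrefix q w × IsSuffix q w × (length q < length w) × (length w ≤ 2 * length q)

-- The overlap w of uα has period p = |w| − |uα| ≤ |uα|, and the occurrence of uβ at
-- position k ≤ p gives the prefix of w of length k + |u| the period k. Running the
-- Euclidean algorithm on the pair (p, k), as in the proof of the Fine–Wilf theorem,
-- shows that the period k extends by one more letter, which is exactly α = β.
module Submission where

open import Defs
open import Data.List using (List; []; _∷_; _++_; [_]; length)
open import Data.List.Properties using (length-++; ++-assoc; ++-identityʳ)
open import Data.Maybe using (Maybe; just; nothing)
open import Data.Maybe.Properties using (just-injective)
open import Data.Nat using (ℕ; zero; suc; _+_; _*_; _<_; _≤_; z≤n; s≤s)
open import Data.Nat.Induction using (<-wellFounded)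
open import Data.Nat.Properties
open import Data.Product using (_×_; _,_; proj₁; proj₂)
open import Data.Sum using (inj₁; inj₂)
open import Induction.WellFounded using (Acc; acc)
open import Relation.Binary.PropositionalEquality
  using (_≡_; refl; sym; trans; cong; subst; subst₂; cong₂; module ≡-Reasoning)

HasPeriod : {B : Set} → (ℕ → B) → ℕ → ℕ → Set
HasPeriod f d L = ∀ i → i + d < L → f i ≡ f (i + d)

module _ {B : Set} {f : ℕ → B} where

  HasPeriod-mono : ∀ {d L L′} → L ≤ L′ → HasPeriod f d L′ → HasPeriod f d L
  HasPeriod-mono L≤L′ per i i+d<L = per i (≤-trans i+d<L L≤L′)

  HasPeriod-difference : ∀ {a c L} →
    HasPeriod f a (a + L) → HasPeriod f (a + c) (a + L) → HasPeriod f c L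
  HasPeriod-difference {a} {c} {L} per-a per-a+c i i+c<L =
    trans (per-a+c i (subst (_< a + L) i+c+a≡i+[a+c] i+c+a<a+L))
          (sym (trans (per-a (i + c) i+c+a<a+L) (cong f i+c+a≡i+[a+c])))
    where
    i+c+a≡i+[a+c] : i + c + a ≡ i + (a + c)
    i+c+a≡i+[a+c] = trans (+-assoc i c a) (cong (i +_) (+-comm c a))
    i+c+a<a+L : i + c + a < a + L
    i+c+a<a+L = subst (i + c + a <_) (+-comm L a) (+-monoˡ-< a i+c<L)

  HasPeriod-extend : ∀ a b m → Acc _<_ (a + b) → 0 < a → a ≤ suc m →
    HasPeriod f a (suc (b + m)) → HasPeriod f b (b + m) → f m ≡ f (b + m)
  HasPeriod-extend a b m (acc rs) 0<a a≤1+m per-a per-b with ≤-total a b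
  ... | inj₁ a≤b with m≤n⇒∃[o]m+o≡n a≤b
  ...   | c , refl = begin
    f m           ≡⟨ HasPeriod-extend a c m (rs (+-monoʳ-< a (m<n+m c 0<a))) 0<a a≤1+m
                       (HasPeriod-mono (s≤s (+-monoˡ-≤ m (m≤n+m c a))) per-a)
                       (HasPeriod-difference
                          (HasPeriod-mono (n≤1+n _)
                             (subst (λ L → HasPeriod f a (suc L)) a+c+m≡a+[c+m] per-a))
                          (subst (HasPeriod f (a + c)) a+c+m≡a+[c+m] per-b)) ⟩
    f (c + m)     ≡⟨ per-a (c + m) (s≤s (≤-reflexive c+m+a≡a+c+m)) ⟩
    f (c + m + a) ≡⟨ cong f c+m+a≡a+c+m ⟩
    f (a + c + m) ∎
    where
    open ≡-Reasoning
    a+c+m≡a+[c+m] : a + c + m ≡ a + (c + m)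
    a+c+m≡a+[c+m] = +-assoc a c m
    c+m+a≡a+c+m : c + m + a ≡ a + c + m
    c+m+a≡a+c+m = trans (+-comm (c + m) a) (sym a+c+m≡a+[c+m])
  HasPeriod-extend a b m _ _ _ _ _ | inj₂ b≤a with m≤n⇒∃[o]m+o≡n b≤a
  HasPeriod-extend .(zero + c) zero m _ _ _ _ _ | inj₂ _ | c , refl = refl
  HasPeriod-extend .(suc b + c) (suc b) m (acc rs) _ (s≤s b+c≤m) per-a per-b | inj₂ _ | c , refl
    with m≤n⇒∃[o]m+o≡n (m+n≤o⇒n≤o b b+c≤m)
  ... | m′ , refl = begin
    f (c + m′)             ≡⟨ sym (HasPeriod-extend (suc b) c m′ (rs (m<m+n (suc b + c) (s≤s z≤n))) (s≤s z≤n)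
                                 (s≤s (+-cancelʳ-≤ c b m′ (subst (b + c ≤_) (+-comm c m′) b+c≤m)))
                                 (HasPeriod-mono (s≤s (m≤n+m (c + m′) b)) per-b)
                                 (HasPeriod-difference per-b (HasPeriod-mono (n≤1+n _) per-a))) ⟩
    f m′                   ≡⟨ per-a m′ (s≤s (≤-reflexive m′+[1+b+c]≡1+b+[c+m′])) ⟩
    f (m′ + (suc b + c))   ≡⟨ cong f m′+[1+b+c]≡1+b+[c+m′] ⟩
    f (suc b + (c + m′))   ∎
    where
    open ≡-Reasoning
    m′+[1+b+c]≡1+b+[c+m′] : m′ + (suc b + c) ≡ suc b + (c + m′)
    m′+[1+b+c]≡1+b+[c+m′] = trans (+-comm m′ (suc b + c)) (+-assoc (suc b) c m′)

module _ {A : Set} where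

  nth : List A → ℕ → Maybe A
  nth []       _       = nothing
  nth (x ∷ xs) zero    = just x
  nth (x ∷ xs) (suc i) = nth xs i

  nth-++ˡ : ∀ (xs ys : List A) {i} → i < length xs → nth (xs ++ ys) i ≡ nth xs i
  nth-++ˡ (x ∷ xs) ys {zero}  _         = refl
  nth-++ˡ (x ∷ xs) ys {suc i} (s≤s i<n) = nth-++ˡ xs ys i<n

  nth-++ʳ : ∀ (xs ys : List A) i → nth (xs ++ ys) (length xs + i) ≡ nth ys i
  nth-++ʳ []       ys i = refl
  nth-++ʳ (x ∷ xs) ys i = nth-++ʳ xs ys i

  nth-++-∷ : ∀ (xs : List A) y ys → nth (xs ++ y ∷ ys) (length xs) ≡ just y
  nth-++-∷ []       y ys = refl
  nth-++-∷ (x ∷ xs) y ys = nth-++-∷ xs y ys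

  nth-just⇒<length : ∀ (xs : List A) {i y} → nth xs i ≡ just y → i < length xs
  nth-just⇒<length (x ∷ xs) {zero}  _  = s≤s z≤n
  nth-just⇒<length (x ∷ xs) {suc i} eq = s≤s (nth-just⇒<length xs eq)

  border-length-bounds : ∀ {w} (l q : List A) → l ++ q ≡ w → length q < length w →
    length w ≤ 2 * length q → 0 < length l × length l ≤ length q
  border-length-bounds {w} l q l++q≡w |q|<|w| |w|≤2|q| =
      +-cancelʳ-< (length q) 0 (length l) (subst (length q <_) |w|≡|l|+|q| |q|<|w|)
    , +-cancelʳ-≤ (length q) (length l) (length q)
        (subst₂ _≤_ |w|≡|l|+|q| (cong (length q +_) (+-identityʳ (length q))) |w|≤2|q|)
    where
    |w|≡|l|+|q| : length w ≡ length l + length q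
    |w|≡|l|+|q| = trans (cong length (sym l++q≡w)) (length-++ l)

  repeated-prefix⇒HasPeriod : ∀ {w} x v y r → x ++ v ++ y ≡ w → v ++ r ≡ w →
    HasPeriod (nth w) (length x) (length x + length v)
  repeated-prefix⇒HasPeriod {w} x v y r at-x at-0 i i+|x|<|x|+|v| = begin
    nth w i                          ≡⟨ cong (λ z → nth z i) (sym at-0) ⟩
    nth (v ++ r) i                   ≡⟨ nth-++ˡ v r i<|v| ⟩
    nth v i                          ≡⟨ sym (nth-++ˡ v y i<|v|) ⟩
    nth (v ++ y) i                   ≡⟨ sym (nth-++ʳ x (v ++ y) i) ⟩
    nth (x ++ v ++ y) (length x + i) ≡⟨ cong₂ nth at-x (+-comm (length x) i) ⟩
    nth w (i + length x)             ∎
    where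
    open ≡-Reasoning
    i<|v| : i < length v
    i<|v| = +-cancelˡ-< (length x) i (length v)
              (subst (_< length x + length v) (+-comm i (length x)) i+|x|<|x|+|v|)

lemma3 : {A : Set} (u : List A) (α β : A) (w : List A) →
    IsOverlapOf w (u ++ [ α ]) → IsFactor (u ++ [ β ]) w → α ≡ β
lemma3 u α β w ((r , prefix) , (l , suffix) , |q|<|w| , |w|≤2|q|) (x , y , factor) =
  just-injective (begin
    just α          ≡⟨ sym w[n]≡α ⟩
    nth w n         ≡⟨ HasPeriod-extend p k n (<-wellFounded (p + k)) 0<p p≤1+n
                         (HasPeriod-mono (subst (suc (k + n) ≤_) (sym p+|q|≡|w|) k+n<|w|) period-p)
                         period-k ⟩
    nth w (k + n)   ≡⟨ w[k+n]≡β ⟩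
    just β          ∎)
  where
  open ≡-Reasoning
  q = u ++ [ α ]
  n = length u
  p = length l
  k = length x
  u++α∷r≡w : u ++ α ∷ r ≡ w
  u++α∷r≡w = trans (sym (++-assoc u [ α ] r)) prefix
  x++u++β∷y≡w : x ++ u ++ β ∷ y ≡ w
  x++u++β∷y≡w = trans (cong (x ++_) (sym (++-assoc u [ β ] y))) factor
  w[n]≡α : nth w n ≡ just α
  w[n]≡α = trans (cong (λ z → nth z n) (sym u++α∷r≡w)) (nth-++-∷ u α r)
  w[k+n]≡β : nth w (k + n) ≡ just β
  w[k+n]≡β = trans (cong (λ z → nth z (k + n)) (sym x++u++β∷y≡w))
                   (trans (nth-++ʳ x (u ++ β ∷ y) n) (nth-++-∷ u β y))
  k+n<|w| : k + n < length w
  k+n<|w| = nth-just⇒<length w w[k+n]≡β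
  0<p×p≤|q| : 0 < p × p ≤ length q
  0<p×p≤|q| = border-length-bounds l q suffix |q|<|w| |w|≤2|q|
  0<p : 0 < p
  0<p = proj₁ 0<p×p≤|q|
  p≤1+n : p ≤ suc n
  p≤1+n = subst (p ≤_) (trans (length-++ u) (+-comm n 1)) (proj₂ 0<p×p≤|q|)
  p+|q|≡|w| : p + length q ≡ length w
  p+|q|≡|w| = trans (sym (length-++ l)) (cong length suffix)
  period-p : HasPeriod (nth w) p (p + length q)
  period-p = repeated-prefix⇒HasPeriod l q [] r (trans (cong (l ++_) (++-identityʳ q)) suffix) prefix
  period-k : HasPeriod (nth w) k (k + n)
  period-k = repeated-prefix⇒HasPeriod x u (β ∷ y) (α ∷ r) x++u++β∷y≡w u++α∷r≡w
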